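{- Let $n>1$ be an integer and let $G$ be a finite group with subgroups $A,B,M$ such that (1) $|A|=|B|=|M|=nk$ and $|G|=n^3k$, where $k=|A\cap B|$; (2) $AM$ and $BM$ are subgroups of $G$ of order $n^2k$; (3) $G=AMB$; (4) $AB\cap BA=A\cup B$. If $a\in A\setminus B$, then $B^a\cap B\le A\cap B$.
   Context: $B^a=a^{ -1}Ba$. -}

module Defs where

open import Data.Nat using (ℕ)
open import Data.Fin using (Fin)
open import Data.Fin.Subset using (Subset; _∈_)
open import Data.Product using (Σ; ∃; ∃-syntax; _×_)
open import Algebra.Core using (Op₁; Op₂)
open import Algebra.Structures using (IsGroup)
open import Relation.Binary.PropositionalEquality using (_≡_)

-- A finite group of order N, presented on the carrier Fin N
-- (every finite group is isomorphic to one of this form).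
record FinGroup (N : ℕ) : Set where
  infixl 7 _∙_
  field
    _∙_     : Op₂ (Fin N)
    ε       : Fin N
    _⁻¹     : Op₁ (Fin N)
    isGroup : IsGroup _≡_ _∙_ ε _⁻¹

module _ {N : ℕ} (G : FinGroup N) where
  open FinGroup G

  record IsSubgroup (H : Subset N) : Set where
    field
      ε-mem : ε ∈ H
      ∙-mem : ∀ {x y} → x ∈ H → y ∈ H → x ∙ y ∈ H
      ⁻¹-mem : ∀ {x} → x ∈ H → x ⁻¹ ∈ H

  InProd : Subset N → Subset N → Fin N → Set
  InProd S T x = ∃[ s ] ∃[ t ] (s ∈ S × t ∈ T × x ≡ s ∙ t)

  InProd₃ : Subset N → Subset N → Subset N → Fin N → Set
  InProd₃ S T U x = ∃[ s ] ∃[ t ] ∃[ u ] (s ∈ S × t ∈ T × u ∈ U × x ≡ s ∙ t ∙ u)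

  InConj : Subset N → Fin N → Fin N → Set
  InConj S a x = ∃[ s ] (s ∈ S × x ≡ a ⁻¹ ∙ s ∙ a)

module Submission where

open import Defs
open import Data.Nat using (ℕ; _<_; _*_; _^_)
open import Data.Fin.Subset using (Subset; _∈_; _∉_; _∩_; ∣_∣)
open import Data.Fin.Subset.Properties using (x∈p∩q⁺)
open import Data.Product using (∃-syntax; _×_; _,_)
open import Data.Sum using (_⊎_; inj₁; inj₂)
open import Data.Empty using (⊥-elim)
open import Function.Bundles using (_⇔_; Equivalence)
open import Level using (0ℓ)
open import Algebra.Bundles using (Group)
import Algebra.Properties.Group as GroupProperties
open import Relation.Binary.PropositionalEquality using (_≡_; refl; sym; trans; cong; subst)

-- Only hypothesis (4) is needed. If b ∈ B and a⁻¹ b a ∈ B, then a (a⁻¹ b a) = b a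
-- lies in both AB and BA, hence in A ∪ B. It cannot lie in B, as then a ∈ B;
-- so b a ∈ A and therefore a⁻¹ b a ∈ A.

module _ {N : ℕ} (G : FinGroup N) where
  open FinGroup G

  group : Group 0ℓ 0ℓ
  group = record { isGroup = isGroup }

  open Group group using (assoc)
  open GroupProperties group using (\\-leftDividesˡ; \\-leftDividesʳ)

  ∙-conj : ∀ a b → a ∙ (a ⁻¹ ∙ b ∙ a) ≡ b ∙ a
  ∙-conj a b = trans (sym (assoc a (a ⁻¹ ∙ b) a)) (cong (_∙ a) (\\-leftDividesˡ a b))

  ∈-cancelˡ : ∀ {H h x} → IsSubgroup G H → h ∈ H → h ∙ x ∈ H → x ∈ H
  ∈-cancelˡ {H} {h} {x} sH h∈H hx∈H =
    subst (_∈ H) (\\-leftDividesʳ h x) (∙-mem (⁻¹-mem h∈H) hx∈H)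
    where open IsSubgroup sH

  conj-∈ : ∀ {A B} → IsSubgroup G A → IsSubgroup G B →
    (∀ y → InProd G A B y × InProd G B A y → y ∈ A ⊎ y ∈ B) →
    ∀ {a x} → a ∈ A → a ∉ B → InConj G B a x → x ∈ B → x ∈ A
  conj-∈ {B = B} sA sB AB∩BA⊆A∪B {a} {x} a∈A a∉B (b , b∈B , refl) x∈B
    with AB∩BA⊆A∪B (a ∙ x) ((a , x , a∈A , x∈B , refl) , (b , a , b∈B , a∈A , ∙-conj a b))
  ... | inj₁ ax∈A = ∈-cancelˡ sA a∈A ax∈A
  ... | inj₂ ax∈B = ⊥-elim (a∉B (∈-cancelˡ sB b∈B (subst (_∈ B) (∙-conj a b) ax∈B)))

lemma2p12 : (n N : ℕ) → 1 < n → (G : FinGroup N) → (A B M : Subset N) →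
    IsSubgroup G A → IsSubgroup G B → IsSubgroup G M →
    ∣ A ∣ ≡ n * ∣ A ∩ B ∣ → ∣ B ∣ ≡ n * ∣ A ∩ B ∣ → ∣ M ∣ ≡ n * ∣ A ∩ B ∣ →
    N ≡ n ^ 3 * ∣ A ∩ B ∣ →
    (∃[ H ] (IsSubgroup G H × (∀ x → (x ∈ H) ⇔ InProd G A M x) × ∣ H ∣ ≡ n ^ 2 * ∣ A ∩ B ∣)) →
    (∃[ H ] (IsSubgroup G H × (∀ x → (x ∈ H) ⇔ InProd G B M x) × ∣ H ∣ ≡ n ^ 2 * ∣ A ∩ B ∣)) →
    (∀ g → InProd₃ G A M B g) →
    (∀ x → (InProd G A B x × InProd G B A x) ⇔ (x ∈ A ⊎ x ∈ B)) →
    ∀ a → a ∈ A → a ∉ B →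
    ∀ x → InConj G B a x → x ∈ B → x ∈ A ∩ B
lemma2p12 _ _ _ G _ _ _ sA sB _ _ _ _ _ _ _ _ AB∩BA≡A∪B a a∈A a∉B x x∈Bᵃ x∈B =
  x∈p∩q⁺ (conj-∈ G sA sB (λ y → Equivalence.to (AB∩BA≡A∪B y)) a∈A a∉B x∈Bᵃ x∈B , x∈B)
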